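{- Let $G$ be a graph with $n$ vertices and edges $e_1,\dots,e_{|E(G)|}$, let $H_1,\dots,H_{|E(G)|}$ be graphs, and let $v$ be a vertex of $G$ of maximum degree $\Delta$. Let $e_{i_1},\dots,e_{i_\Delta}$ be the edges of $G$ incident to $v$, let $n_{i_k}$ be the order of $H_{i_k}$ (the graph corresponding to $e_{i_k}$), and let $t=\max_{1\le i\le |E(G)|}|V(H_i)|$. Then $$\Delta+1+\sum_{k=1}^{\Delta} n_{i_k}\le \chi_{\le 2}(G\diamond(H_1,\dots,H_{|E(G)|}))\le n(t+1).$$
   Context: For a simple graph $G$ with edge set $\{e_1,\dots,e_m\}$ and simple graphs $H_1,\dots,H_m$, the generalized edge corona product $G\diamond(H_1,\dots,H_m)$ is the graph obtained by taking one (vertex-disjoint) copy of each of $G,H_1,\dots,H_m$ and joining both end vertices of the $i$-th edge $e_i$ of $G$ to every vertex of $H_i$; $H_i$ is called the graph corresponding to $e_i$. A $k$-distance coloring of a graph is a vertex coloring in which any two distinct vertices at distance at most $k$ receive different colors; $\chi_{\le k}$ denotes the minimum number of colors in a $k$-distance coloring. -}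

module Defs where

open import Data.Nat using (ℕ; _+_; _⊔_)
open import Data.Fin using (Fin; _≟_)
open import Data.List using (List; map; foldr; allFin)
open import Data.Nat.ListAction using (sum)
open import Data.Product using (Σ; _×_; _,_; proj₁; proj₂)
open import Data.Sum using (_⊎_; inj₁; inj₂)
open import Data.Bool using (Bool; if_then_else_)
open import Relation.Nullary using (¬_)
open import Relation.Nullary.Decidable using (⌊_⌋; _⊎-dec_)
open import Relation.Binary.PropositionalEquality using (_≡_; _≢_)

record Graph : Set₁ where
  field
    order  : ℕ
    Adj    : Fin order → Fin order → Set
    sym    : ∀ {x y} → Adj x y → Adj y x
    irrefl : ∀ {x} → ¬ Adj x x
open Graph public

SameEdge : ∀ {n} → Fin n × Fin n → Fin n × Fin n → Set
SameEdge (a , b) (c , d) = (a ≡ c × b ≡ d) ⊎ (a ≡ d × b ≡ c)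

-- A simple graph G on vertex set Fin n with an explicit enumeration
-- e_0, …, e_(m-1) of its edge set (no loops, no repeated edges).
record EdgeGraph : Set where
  field
    n        : ℕ
    m        : ℕ
    ends     : Fin m → Fin n × Fin n
    loopless : ∀ i → proj₁ (ends i) ≢ proj₂ (ends i)
    distinct : ∀ i j → SameEdge (ends i) (ends j) → i ≡ j
open EdgeGraph public

GAdj : (G : EdgeGraph) → Fin (n G) → Fin (n G) → Set
GAdj G u w = Σ (Fin (m G)) λ i → SameEdge (ends G i) (u , w)

Incident : ∀ {k} → Fin k → Fin k × Fin k → Set
Incident u (a , b) = (a ≡ u) ⊎ (b ≡ u)

incident? : ∀ {k} → Fin k → Fin k × Fin k → Bool
incident? u (a , b) = ⌊ (a ≟ u) ⊎-dec (b ≟ u) ⌋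

deg : (G : EdgeGraph) → Fin (n G) → ℕ
deg G u = sum (map (λ i → if incident? u (ends G i) then 1 else 0) (allFin (m G)))

incOrderSum : (G : EdgeGraph) → (Fin (m G) → Graph) → Fin (n G) → ℕ
incOrderSum G H u =
  sum (map (λ i → if incident? u (ends G i) then order (H i) else 0) (allFin (m G)))

-- t = max_i |V(H_i)|  (0 if G has no edges)
maxOrder : (G : EdgeGraph) → (Fin (m G) → Graph) → ℕ
maxOrder G H = foldr _⊔_ 0 (map (λ i → order (H i)) (allFin (m G)))

CVertex : (G : EdgeGraph) → (Fin (m G) → Graph) → Set
CVertex G H = Fin (n G) ⊎ Σ (Fin (m G)) (λ i → Fin (order (H i)))

data CAdj (G : EdgeGraph) (H : Fin (m G) → Graph) : CVertex G H → CVertex G H → Set where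
  gg : ∀ {u w} → GAdj G u w → CAdj G H (inj₁ u) (inj₁ w)
  gh : ∀ {u} i (x : Fin (order (H i))) → Incident u (ends G i) →
       CAdj G H (inj₁ u) (inj₂ (i , x))
  hg : ∀ {u} i (x : Fin (order (H i))) → Incident u (ends G i) →
       CAdj G H (inj₂ (i , x)) (inj₁ u)
  hh : ∀ i {x y : Fin (order (H i))} → Adj (H i) x y →
       CAdj G H (inj₂ (i , x)) (inj₂ (i , y))

Within2 : (G : EdgeGraph) (H : Fin (m G) → Graph) → CVertex G H → CVertex G H → Set
Within2 G H x y = CAdj G H x y ⊎ Σ (CVertex G H) (λ z → CAdj G H x z × CAdj G H z y)

Is2DistColoring : (G : EdgeGraph) (H : Fin (m G) → Graph) (k : ℕ) → (CVertex G H → Fin k) → Set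
Is2DistColoring G H k c = ∀ x y → x ≢ y → Within2 G H x y → c x ≢ c y

TwoDistColorable : (G : EdgeGraph) (H : Fin (m G) → Graph) → ℕ → Set
TwoDistColorable G H k = Σ (CVertex G H → Fin k) (Is2DistColoring G H k)

module Submission where

-- Every vertex of the closed neighbourhood N[v] of a vertex v
-- of G is v itself or adjacent to v, so any two of them are at distance at
-- most 2 and receive different colours.  N[v] contains v, the other end of
-- every edge e_i at v, and all of H_i for such e_i; these vertices are pairwise
-- distinct (distinct edges at v have distinct other ends), so listing them
-- without repetition gives deg v + 1 + Σ |V(H_i)| colours.  The lower bound
-- holds for every vertex v, in particular for one of maximum degree.
--
-- Colour with pairs (slot, label) ∈ Fin n × Fin (t + 1): a vertex
-- u of G gets (u, t) and vertex x < t of H_i gets (s(e_i), x), where the slot of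
-- an edge {a, b} is s = (a + b) mod n.  Edges sharing an end u have different
-- slots, since b ↦ (u + b) mod n is injective; hence two vertices of distinct
-- copies H_i, H_j at distance ≤ 2 (necessarily through a common end of e_i and
-- e_j) get different colours.

open import Defs
open import Data.Nat using (ℕ; suc; _+_; _*_; _∸_; _≤_; _<_; _⊔_; _%_; NonZero)
open import Data.Nat.Properties
  using (≤-trans; <⇒≤; m≤m⊔n; m≤n⊔m; +-comm; +-assoc; m+[n∸m]≡n; +-commutativeSemigroup; module ≤-Reasoning)
open import Data.Nat.DivMod using (_mod_; %-distribˡ-+; [m+n]%n≡m%n; m<n⇒m%n≡m)
open import Data.Nat.ListAction using (sum)
open import Algebra.Properties.CommutativeSemigroup +-commutativeSemigroup using (interchange)
open import Data.Fin using (Fin; toℕ; combine; inject≤; _↑ˡ_; _↑ʳ_; splitAt; _≟_)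
open import Data.Fin.Properties
  using (toℕ-injective; toℕ-fromℕ<; toℕ<n; nonZeroIndex; injective⇒≤; combine-injective;
         inject≤-injective; ↑ˡ-injective; splitAt-↑ˡ; splitAt-↑ʳ)
open import Data.Product using (Σ; ∃; _×_; _,_; proj₁; proj₂)
open import Data.Sum using (_⊎_; inj₁; inj₂)
open import Data.Sum.Properties using (inj₁-injective)
open import Data.Bool using (if_then_else_)
open import Data.List using (List; []; _∷_; map; concatMap; allFin; length; foldr; lookup; tabulate)
open import Data.List.Properties using (length-map; length-++; length-tabulate; map-cong)
open import Data.List.Relation.Unary.All as All using (All; []; _∷_)
import Data.List.Relation.Unary.All.Properties as AllP
open import Data.List.Relation.Unary.AllPairs as AllPairs using (AllPairs; []; _∷_)
import Data.List.Relation.Unary.AllPairs.Properties as AllPairsP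
open import Data.List.Relation.Unary.Any using (here; there; satisfied)
open import Data.List.Relation.Unary.Unique.Propositional using (Unique)
import Data.List.Relation.Unary.Unique.Propositional.Properties as UniqueP
open import Data.List.Relation.Binary.Disjoint.Propositional using (Disjoint)
open import Data.List.Membership.Propositional using (_∈_)
open import Data.List.Membership.Propositional.Properties
  using (∈-lookup; ∈-allFin; ∈-tabulate⁻; ∈-concatMap⁻)
open import Function using (_∘_)
open import Function.Definitions using (Injective)
open import Relation.Nullary using (Dec; yes; no; contradiction)
open import Relation.Nullary.Decidable using (⌊_⌋; _⊎-dec_)
open import Relation.Binary.PropositionalEquality
  using (_≡_; _≢_; refl; trans; cong; subst; module ≡-Reasoning) renaming (sym to ≡-sym)

lookup-injective : ∀ {A : Set} {xs : List A} → Unique xs → Injective _≡_ _≡_ (lookup xs)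
lookup-injective (_ ∷ _) {Fin.zero} {Fin.zero} _ = refl
lookup-injective (x∉ ∷ _) {Fin.zero} {Fin.suc j} eq = contradiction eq (All.lookup x∉ (∈-lookup j))
lookup-injective (x∉ ∷ _) {Fin.suc i} {Fin.zero} eq = contradiction (≡-sym eq) (All.lookup x∉ (∈-lookup i))
lookup-injective (_ ∷ u) {Fin.suc i} {Fin.suc j} eq = cong Fin.suc (lookup-injective u eq)

unique⇒length≤ : ∀ {k} {xs : List (Fin k)} → Unique xs → length xs ≤ k
unique⇒length≤ u = injective⇒≤ (lookup-injective u)

allPairs-restrict : ∀ {A : Set} {P : A → Set} {R S : A → A → Set} →
  (∀ {x y} → P x → P y → R x y → S x y) →
  ∀ {xs} → All P xs → AllPairs R xs → AllPairs S xs
allPairs-restrict imp [] [] = []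
allPairs-restrict imp (px ∷ pxs) (rx ∷ rxs) =
  All.zipWith (λ (py , r) → imp px py r) (pxs , rx) ∷ allPairs-restrict imp pxs rxs

length-concatMap : ∀ {A B : Set} (f : A → List B) xs →
  length (concatMap f xs) ≡ sum (map (length ∘ f) xs)
length-concatMap f [] = refl
length-concatMap f (x ∷ xs) =
  trans (length-++ (f x)) (cong (length (f x) +_) (length-concatMap f xs))

sum-map-+ : ∀ {A : Set} (f g : A → ℕ) xs →
  sum (map (λ x → f x + g x) xs) ≡ sum (map f xs) + sum (map g xs)
sum-map-+ f g [] = refl
sum-map-+ f g (x ∷ xs) =
  trans (cong (f x + g x +_) (sum-map-+ f g xs))
        (interchange (f x) (g x) (sum (map f xs)) (sum (map g xs)))

≤-maximum : ∀ {A : Set} (f : A → ℕ) {x xs} → x ∈ xs → f x ≤ foldr _⊔_ 0 (map f xs)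
≤-maximum f {xs = y ∷ _} (here refl) = m≤m⊔n (f y) _
≤-maximum f {xs = y ∷ _} (there x∈) = ≤-trans (≤-maximum f x∈) (m≤n⊔m (f y) _)

-- Adding a fixed u ≤ d is injective on residues modulo d:
-- subtracting u again is adding d ∸ u.
+-mod-cancelˡ : ∀ d .{{_ : NonZero d}} u {p q} → u ≤ d → p < d → q < d →
  (u + p) % d ≡ (u + q) % d → p ≡ q
+-mod-cancelˡ d u {p} {q} u≤d p<d q<d eq = begin
  p                               ≡⟨ recover p<d ⟩
  ((u + p) % d + (d ∸ u) % d) % d ≡⟨ cong (λ r → (r + (d ∸ u) % d) % d) eq ⟩
  ((u + q) % d + (d ∸ u) % d) % d ≡⟨ recover q<d ⟨
  q                               ∎
  where
  open ≡-Reasoning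
  recover : ∀ {r} → r < d → r ≡ ((u + r) % d + (d ∸ u) % d) % d
  recover {r} r<d = begin
    r                               ≡⟨ m<n⇒m%n≡m r<d ⟨
    r % d                           ≡⟨ [m+n]%n≡m%n r d ⟨
    (r + d) % d                     ≡⟨ cong (λ z → (r + z) % d) (m+[n∸m]≡n u≤d) ⟨
    (r + (u + (d ∸ u))) % d         ≡⟨ cong (_% d) (+-assoc r u (d ∸ u)) ⟨
    (r + u + (d ∸ u)) % d           ≡⟨ cong (λ z → (z + (d ∸ u)) % d) (+-comm r u) ⟩
    (u + r + (d ∸ u)) % d           ≡⟨ %-distribˡ-+ (u + r) (d ∸ u) d ⟩
    ((u + r) % d + (d ∸ u) % d) % d ∎

↑ˡ≢↑ʳ : ∀ {a b} (i : Fin a) (j : Fin b) → i ↑ˡ b ≢ a ↑ʳ j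
↑ˡ≢↑ʳ {a} {b} i j eq
  with () ← trans (≡-sym (splitAt-↑ˡ a i b)) (trans (cong (splitAt a) eq) (splitAt-↑ʳ a b j))

module _ {k : ℕ} where

  Pair : Set
  Pair = Fin k × Fin k

  SameEdge-sym : ∀ {e f : Pair} → SameEdge e f → SameEdge f e
  SameEdge-sym (inj₁ (refl , refl)) = inj₁ (refl , refl)
  SameEdge-sym (inj₂ (refl , refl)) = inj₂ (refl , refl)

  SameEdge-trans : ∀ {e f g : Pair} → SameEdge e f → SameEdge f g → SameEdge e g
  SameEdge-trans (inj₁ (refl , refl)) fg = fg
  SameEdge-trans (inj₂ (refl , refl)) (inj₁ (refl , refl)) = inj₂ (refl , refl)
  SameEdge-trans (inj₂ (refl , refl)) (inj₂ (refl , refl)) = inj₁ (refl , refl)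

  incident-dec : (u : Fin k) (e : Pair) → Dec (Incident u e)
  incident-dec u (a , b) = (a ≟ u) ⊎-dec (b ≟ u)

  otherEnd : ∀ {u} (e : Pair) → Incident u e → Fin k
  otherEnd (a , b) (inj₁ _) = b
  otherEnd (a , b) (inj₂ _) = a

  otherEnd-spec : ∀ {u} (e : Pair) (p : Incident u e) → SameEdge e (u , otherEnd e p)
  otherEnd-spec (a , b) (inj₁ refl) = inj₁ (refl , refl)
  otherEnd-spec (a , b) (inj₂ refl) = inj₂ (refl , refl)

  otherEnd-≢ : ∀ {u} (e : Pair) (p : Incident u e) → proj₁ e ≢ proj₂ e → otherEnd e p ≢ u
  otherEnd-≢ (a , b) (inj₁ refl) a≢b b≡a = a≢b (≡-sym b≡a)
  otherEnd-≢ (a , b) (inj₂ refl) a≢b a≡b = a≢b a≡b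

  sameOtherEnd⇒SameEdge : ∀ {u} (e f : Pair) (p : Incident u e) (q : Incident u f) →
    otherEnd e p ≡ otherEnd f q → SameEdge e f
  sameOtherEnd⇒SameEdge e f p q eq =
    SameEdge-trans (otherEnd-spec e p)
      (SameEdge-sym (SameEdge-trans (otherEnd-spec f q) (inj₁ (refl , ≡-sym eq))))

module LowerBound (G : EdgeGraph) (H : Fin (m G) → Graph) (v : Fin (n G)) where

  V : Set
  V = CVertex G H

  -- w lies in the closed neighbourhood N[v] (adjacency is recorded both ways).
  InClosedNbhd : V → Set
  InClosedNbhd w = (w ≡ inj₁ v) ⊎ (CAdj G H w (inj₁ v) × CAdj G H (inj₁ v) w)

  closedNbhd-within2 : ∀ {x y} → x ≢ y → InClosedNbhd x → InClosedNbhd y → Within2 G H x y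
  closedNbhd-within2 x≢y (inj₁ refl) (inj₁ refl) = contradiction refl x≢y
  closedNbhd-within2 x≢y (inj₁ refl) (inj₂ (_ , vy)) = inj₁ vy
  closedNbhd-within2 x≢y (inj₂ (xv , _)) (inj₁ refl) = inj₁ xv
  closedNbhd-within2 x≢y (inj₂ (xv , _)) (inj₂ (_ , vy)) = inj₂ (inj₁ v , xv , vy)

  closedNbhd-colour-bound : ∀ {k} (c : V → Fin k) → Is2DistColoring G H k c →
    ∀ {xs} → Unique xs → All InClosedNbhd xs → length xs ≤ k
  closedNbhd-colour-bound {k} c proper {xs} unique inNbhd = begin
    length xs         ≡⟨ length-map c xs ⟨
    length (map c xs) ≤⟨ unique⇒length≤ (AllPairsP.map⁺ coloursDistinct) ⟩
    k                 ∎
    where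
    open ≤-Reasoning
    coloursDistinct : AllPairs (λ x y → c x ≢ c y) xs
    coloursDistinct = allPairs-restrict
      (λ px py x≢y → proper _ _ x≢y (closedNbhd-within2 x≢y px py)) inNbhd unique

  InBlock : Fin (m G) → V → Set
  InBlock i w = Σ (Incident v (ends G i)) λ p →
    (w ≡ inj₁ (otherEnd (ends G i) p)) ⊎ ∃ λ (x : Fin (order (H i))) → w ≡ inj₂ (i , x)

  edgeBlock : (i : Fin (m G)) → Dec (Incident v (ends G i)) → List V
  edgeBlock i (yes p) = inj₁ (otherEnd (ends G i) p) ∷ tabulate (λ x → inj₂ (i , x))
  edgeBlock i (no _) = []

  block : Fin (m G) → List V
  block i = edgeBlock i (incident-dec v (ends G i))

  closedNbhd : List V
  closedNbhd = inj₁ v ∷ concatMap block (allFin (m G))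

  ∈-edgeBlock : ∀ {w} i d → w ∈ edgeBlock i d → InBlock i w
  ∈-edgeBlock i (yes p) (here refl) = p , inj₁ refl
  ∈-edgeBlock i (yes p) (there w∈) = p , inj₂ (∈-tabulate⁻ w∈)

  ∈-blocks : ∀ {w} → w ∈ concatMap block (allFin (m G)) → ∃ λ i → InBlock i w
  ∈-blocks w∈ with i , w∈block ← satisfied (∈-concatMap⁻ block {allFin (m G)} w∈) =
    i , ∈-edgeBlock i (incident-dec v (ends G i)) w∈block

  inBlock-closedNbhd : ∀ {i w} → InBlock i w → InClosedNbhd w
  inBlock-closedNbhd {i} (p , inj₁ refl) =
    inj₂ (gg (i , SameEdge-trans (otherEnd-spec (ends G i) p) (inj₂ (refl , refl))) ,
          gg (i , otherEnd-spec (ends G i) p))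
  inBlock-closedNbhd {i} (p , inj₂ (x , refl)) = inj₂ (hg i x p , gh i x p)

  inBlock-≢v : ∀ {i w} → InBlock i w → inj₁ v ≢ w
  inBlock-≢v {i} (p , inj₁ refl) v≡w =
    otherEnd-≢ (ends G i) p (loopless G i) (≡-sym (inj₁-injective v≡w))
  inBlock-≢v (p , inj₂ (x , refl)) ()

  inBlock-unique : ∀ {i j w} → InBlock i w → InBlock j w → i ≡ j
  inBlock-unique {i} {j} (p , inj₁ refl) (q , inj₁ eq) =
    distinct G i j (sameOtherEnd⇒SameEdge (ends G i) (ends G j) p q (inj₁-injective eq))
  inBlock-unique (p , inj₁ refl) (q , inj₂ (y , ()))
  inBlock-unique (p , inj₂ (x , refl)) (q , inj₁ ())
  inBlock-unique (p , inj₂ (x , refl)) (q , inj₂ (y , refl)) = refl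

  edgeBlock-unique : ∀ i d → Unique (edgeBlock i d)
  edgeBlock-unique i (yes p) =
    AllP.tabulate⁺ (λ x ()) ∷ UniqueP.tabulate⁺ (λ { refl → refl })
  edgeBlock-unique i (no _) = []

  closedNbhd-unique : Unique closedNbhd
  closedNbhd-unique =
    All.tabulate (λ w∈ → inBlock-≢v (proj₂ (∈-blocks w∈))) ∷
    UniqueP.concat⁺
      (AllP.map⁺ (All.universal (λ i → edgeBlock-unique i _) (allFin (m G))))
      (AllPairsP.map⁺ (AllPairs.map blocksDisjoint (UniqueP.allFin⁺ (m G))))
    where
    blocksDisjoint : ∀ {i j} → i ≢ j → Disjoint (block i) (block j)
    blocksDisjoint {i} {j} i≢j (w∈i , w∈j) =
      i≢j (inBlock-unique (∈-edgeBlock i _ w∈i) (∈-edgeBlock j _ w∈j))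

  closedNbhd-inClosedNbhd : All InClosedNbhd closedNbhd
  closedNbhd-inClosedNbhd =
    inj₁ refl ∷ All.tabulate (λ w∈ → inBlock-closedNbhd (proj₂ (∈-blocks w∈)))

  length-edgeBlock : ∀ i d → length (edgeBlock i d) ≡
    (if ⌊ d ⌋ then 1 else 0) + (if ⌊ d ⌋ then order (H i) else 0)
  length-edgeBlock i (yes p) = cong suc (length-tabulate _)
  length-edgeBlock i (no _) = refl

  length-closedNbhd : length closedNbhd ≡ deg G v + 1 + incOrderSum G H v
  length-closedNbhd = begin
    suc (length (concatMap block all))                 ≡⟨ cong suc (length-concatMap block all) ⟩
    suc (sum (map (length ∘ block) all))               ≡⟨ cong (suc ∘ sum) (map-cong blockLength all) ⟩
    suc (sum (map (λ i → indicator i + weight i) all)) ≡⟨ cong suc (sum-map-+ indicator weight all) ⟩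
    suc (deg G v + incOrderSum G H v)                  ≡⟨ cong (_+ incOrderSum G H v) (+-comm 1 (deg G v)) ⟩
    deg G v + 1 + incOrderSum G H v                    ∎
    where
    open ≡-Reasoning
    all : List (Fin (m G))
    all = allFin (m G)
    indicator weight : Fin (m G) → ℕ
    indicator i = if incident? v (ends G i) then 1 else 0
    weight i = if incident? v (ends G i) then order (H i) else 0
    blockLength : ∀ i → length (block i) ≡ indicator i + weight i
    blockLength i = length-edgeBlock i (incident-dec v (ends G i))

  lowerBound : ∀ k → TwoDistColorable G H k → deg G v + 1 + incOrderSum G H v ≤ k
  lowerBound k (c , proper) = subst (_≤ k) length-closedNbhd
    (closedNbhd-colour-bound c proper closedNbhd-unique closedNbhd-inClosedNbhd)

module UpperBound (G : EdgeGraph) (H : Fin (m G) → Graph) where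

  t : ℕ
  t = maxOrder G H

  order≤t : ∀ i → order (H i) ≤ t
  order≤t i = ≤-maximum (λ j → order (H j)) (∈-allFin i)

  slot : Fin (n G) → Fin (n G) → Fin (n G)
  slot a b = _mod_ (toℕ a + toℕ b) (n G) {{nonZeroIndex a}}

  slot-comm : ∀ a b → slot a b ≡ slot b a
  slot-comm a b = cong (λ s → _mod_ s (n G) {{nonZeroIndex a}}) (+-comm (toℕ a) (toℕ b))

  slot-injectiveʳ : ∀ u {p q} → slot u p ≡ slot u q → p ≡ q
  slot-injectiveʳ u {p} {q} eq = toℕ-injective
    (+-mod-cancelˡ (n G) {{nonZeroIndex u}} (toℕ u) (<⇒≤ (toℕ<n u)) (toℕ<n p) (toℕ<n q)
      (trans (≡-sym (toℕ-fromℕ< _)) (trans (cong toℕ eq) (toℕ-fromℕ< _))))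

  edgeSlot : Pair → Fin (n G)
  edgeSlot (a , b) = slot a b

  edgeSlot-otherEnd : ∀ {u} (e : Pair) (p : Incident u e) → edgeSlot e ≡ slot u (otherEnd e p)
  edgeSlot-otherEnd (a , b) (inj₁ refl) = refl
  edgeSlot-otherEnd (a , b) (inj₂ refl) = slot-comm a b

  sameSlot⇒SameEdge : ∀ {u} (e f : Pair) → Incident u e → Incident u f →
    edgeSlot e ≡ edgeSlot f → SameEdge e f
  sameSlot⇒SameEdge {u} e f p q eq = sameOtherEnd⇒SameEdge e f p q
    (slot-injectiveʳ u (trans (≡-sym (edgeSlot-otherEnd e p)) (trans eq (edgeSlot-otherEnd f q))))

  -- Two vertices of copies H_i, H_j within distance 2 whose edges have the
  -- same slot lie in the same copy: otherwise their common neighbour is a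
  -- common end of e_i and e_j.
  sameSlot⇒sameCopy : ∀ {i j x y} → Within2 G H (inj₂ (i , x)) (inj₂ (j , y)) →
    edgeSlot (ends G i) ≡ edgeSlot (ends G j) → i ≡ j
  sameSlot⇒sameCopy (inj₁ (hh _ _)) _ = refl
  sameSlot⇒sameCopy {i} {j} (inj₂ (inj₁ _ , hg _ _ p , gh _ _ q)) eq =
    distinct G i j (sameSlot⇒SameEdge (ends G i) (ends G j) p q eq)
  sameSlot⇒sameCopy (inj₂ (inj₂ _ , hh _ _ , hh _ _)) _ = refl

  copyLabel : ∀ i → Fin (order (H i)) → Fin (t + 1)
  copyLabel i x = inject≤ x (order≤t i) ↑ˡ 1

  baseLabel : Fin (t + 1)
  baseLabel = t ↑ʳ Fin.zero

  colouring : CVertex G H → Fin (n G * (t + 1))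
  colouring (inj₁ u) = combine u baseLabel
  colouring (inj₂ (i , x)) = combine (edgeSlot (ends G i)) (copyLabel i x)

  -- G-vertices are told apart by their first coordinate, G- from H-vertices by
  -- the label, and H-vertices by sameSlot⇒sameCopy and then the label.
  colouring-proper : Is2DistColoring G H (n G * (t + 1)) colouring
  colouring-proper (inj₁ u) (inj₁ w) u≢w _ eq =
    u≢w (cong inj₁ (proj₁ (combine-injective u _ w _ eq)))
  colouring-proper (inj₁ u) (inj₂ (j , y)) _ _ eq =
    ↑ˡ≢↑ʳ _ Fin.zero (≡-sym (proj₂ (combine-injective u baseLabel _ (copyLabel j y) eq)))
  colouring-proper (inj₂ (i , x)) (inj₁ w) _ _ eq =
    ↑ˡ≢↑ʳ _ Fin.zero (proj₂ (combine-injective _ (copyLabel i x) w baseLabel eq))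
  colouring-proper (inj₂ (i , x)) (inj₂ (j , y)) x≢y near eq
    with slots , labels ← combine-injective _ _ _ _ eq
    with refl ← sameSlot⇒sameCopy near slots =
    x≢y (cong (λ z → inj₂ (i , z)) (inject≤-injective _ _ x y (↑ˡ-injective 1 _ _ labels)))

  upperBound : TwoDistColorable G H (n G * (t + 1))
  upperBound = colouring , colouring-proper

-- Main theorem.
mainTheorem6 : (G : EdgeGraph) (H : Fin (m G) → Graph) (v : Fin (n G)) →
    (∀ w → deg G w ≤ deg G v) →
    ((k : ℕ) → TwoDistColorable G H k → deg G v + 1 + incOrderSum G H v ≤ k)
    × TwoDistColorable G H (n G * (maxOrder G H + 1))
mainTheorem6 G H v _ = LowerBound.lowerBound G H v , UpperBound.upperBound G H
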